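{- Let $\theta$ be an automorphism of $\mathcal{H}$. If $X\in[\omega]^{<\omega}$, then $\theta(X)\in[\omega]^{<\omega}$. If $(i,a)\in\omega\times\{0,1\}$, then $\theta(i,a)=(i,0)$ or $\theta(i,a)=(i,1)$.
   Context: $\mathcal{H}=(H,\{D_i\}_{i<\omega},\{E_i\}_{i<\omega})$ is the structure with universe $H=[\omega]^{<\omega}\cup(\omega\times\{0,1\})$, where $[\omega]^{<\omega}$ is the set of finite subsets of $\omega$ (identified with their characteristic functions, $X(i)\in\{0,1\}$). The $E_i$ are binary relations on $[\omega]^{<\omega}$: $E_i(X,Y)$ iff $X\triangle Y=\{i\}$. The $D_i$ are binary relations: for $X\in[\omega]^{<\omega}$, $i<\omega$, $a<2$, $D_i(X,(i,a))$ iff $X(i)=a$; no other $D_i$ or $E_i$ instances hold. -}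

module Defs where

open import Data.Nat using (ℕ; zero; suc; _/_; _%_)
open import Data.Bool using (Bool; true; false)
open import Data.Product using (_×_; _,_)
open import Data.Sum using (_⊎_; inj₁; inj₂)
open import Data.Empty using (⊥)
open import Relation.Binary.PropositionalEquality using (_≡_; _≢_)
open import Function.Bundles using (_⤖_; _⇔_; Bijection)

-- Finite subsets of ω, [ω]^{<ω}, coded canonically by natural numbers:
-- the code n stands for the set { i | bit i of n is 1 } (n = Σ_{i∈X} 2^i).
-- This is a bijection between ℕ and [ω]^{<ω}.
FinSub : Set
FinSub = ℕ

parity : ℕ → Bool
parity zero = false
parity (suc zero) = true
parity (suc (suc n)) = parity n

χ : FinSub → ℕ → Bool
χ X zero = parity X
χ X (suc i) = χ (X / 2) i

H : Set
H = FinSub ⊎ (ℕ × Bool)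

E : ℕ → H → H → Set
E i (inj₁ X) (inj₁ Y) = ∀ j → (χ X j ≢ χ Y j) ⇔ (j ≡ i)
E i _ _ = ⊥

D : ℕ → H → H → Set
D i (inj₁ X) (inj₂ (j , a)) = (j ≡ i) × (χ X i ≡ a)
D i _ _ = ⊥

record Automorphism : Set where
  field
    bij : H ⤖ H
  θ : H → H
  θ = Bijection.to bij
  field
    presD : ∀ i x y → D i x y ⇔ D i (θ x) (θ y)
    presE : ∀ i x y → E i x y ⇔ E i (θ x) (θ y)

-- Every element of H is D-related to something: X to (0, X(0)), and (i, a) to any
-- finite set X with X(i) = a. Since θ preserves D, θ x is again D-related, and D only
-- relates a finite set on the left to a pair (i, b) on the right with the same index i.
module Submission where

open import Defs
open import Data.Nat using (ℕ; zero; suc; _*_)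
open import Data.Nat.DivMod using (m*n/n≡m)
open import Data.Bool using (Bool; true; false)
open import Data.Product using (_×_; _,_; ∃)
open import Data.Sum using (_⊎_; inj₁; inj₂)
open import Relation.Binary.PropositionalEquality using (_≡_; refl; sym; subst)
open import Function.Bundles using (Equivalence)

singleton : ℕ → FinSub
singleton zero = 1
singleton (suc i) = singleton i * 2

χ-empty : ∀ i → χ 0 i ≡ false
χ-empty zero = refl
χ-empty (suc i) = χ-empty i

χ-singleton : ∀ i → χ (singleton i) i ≡ true
χ-singleton zero = refl
χ-singleton (suc i) =
  subst (λ X → χ X i ≡ true) (sym (m*n/n≡m (singleton i) 2)) (χ-singleton i)

χ-realise : ∀ i a → ∃ λ X → χ X i ≡ a
χ-realise i false = 0 , χ-empty i
χ-realise i true = singleton i , χ-singleton i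

D-domain : ∀ {i} u v → D i u v → ∃ λ X → u ≡ inj₁ X
D-domain (inj₁ X) (inj₂ _) _ = X , refl

D-codomain : ∀ {i} u v → D i u v → (v ≡ inj₂ (i , false)) ⊎ (v ≡ inj₂ (i , true))
D-codomain (inj₁ _) (inj₂ (_ , false)) (refl , _) = inj₁ refl
D-codomain (inj₁ _) (inj₂ (_ , true)) (refl , _) = inj₂ refl

module _ (φ : Automorphism) where
  open Automorphism φ

  θ-preserves-D : ∀ {i} x y → D i x y → D i (θ x) (θ y)
  θ-preserves-D x y = Equivalence.to (presD _ x y)

  θ-finite : (X : FinSub) → ∃ λ Y → θ (inj₁ X) ≡ inj₁ Y
  θ-finite X = D-domain (θ (inj₁ X)) (θ (inj₂ (0 , χ X 0)))
    (θ-preserves-D (inj₁ X) (inj₂ (0 , χ X 0)) (refl , refl))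

  θ-pair : (i : ℕ) (a : Bool) →
    (θ (inj₂ (i , a)) ≡ inj₂ (i , false)) ⊎ (θ (inj₂ (i , a)) ≡ inj₂ (i , true))
  θ-pair i a with χ-realise i a
  ... | X , X[i]≡a = D-codomain (θ (inj₁ X)) (θ (inj₂ (i , a)))
    (θ-preserves-D (inj₁ X) (inj₂ (i , a)) (refl , X[i]≡a))

lemma3p4 : (φ : Automorphism) →
    ((X : FinSub) → ∃ λ (Y : FinSub) → Automorphism.θ φ (inj₁ X) ≡ inj₁ Y)
    × ((i : ℕ) (a : Bool) →
        (Automorphism.θ φ (inj₂ (i , a)) ≡ inj₂ (i , false))
        ⊎ (Automorphism.θ φ (inj₂ (i , a)) ≡ inj₂ (i , true)))
lemma3p4 φ = θ-finite φ , θ-pair φ
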